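{- Let $G\in\{K_5-e,\ 2\circ K_4\}$ and $n\equiv 1$ or $4\pmod{12}$. If there exists a 2-$(n,4,1)$ packing leaving ${\rm CP}(4)$, then there exists a 2-$(n,4,1)$ packing of size $\frac{1}{6}\left(\binom{n}{2}-18\right)$ whose leave contains $G$ as a subgraph.
   Context: A 2-$(n,4,1)$ packing is a pair $(X,\mathcal{A})$ with $|X|=n$ and $\mathcal{A}$ a set of 4-subsets (blocks) of $X$ such that every 2-subset of $X$ lies in at most one block; its size is $|\mathcal{A}|$ and its leave is the graph on $X$ whose edges are the 2-subsets contained in no block. "Leaving ${\rm CP}(4)$" means the leave, after discarding isolated vertices, is isomorphic to ${\rm CP}(4)$, i.e. $K_8$ minus a perfect matching. $K_5-e$ is $K_5$ minus one edge; $2\circ K_4$ is two copies of $K_4$ sharing exactly one edge. -}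

module Defs where

open import Data.Nat using (ℕ; _/_; _∸_; _%_)
open import Data.Nat.Combinatorics using (_C_)
open import Data.Fin using (Fin; toℕ)
open import Data.Fin.Subset using (Subset; _∈_; ∣_∣)
open import Data.List using (List; length; lookup)
open import Data.Product using (Σ; ∃; _×_; _,_)
open import Data.Sum using (_⊎_)
open import Relation.Nullary using (¬_)
open import Relation.Binary.PropositionalEquality using (_≡_; _≢_)
open import Function.Definitions using (Injective)

IsBlock : ∀ {n} → Subset n → Set
IsBlock B = ∣ B ∣ ≡ 4

-- The collection is given
-- as a list; the "at most one" condition (applied to any pair inside a block)
-- forces the list to have no repeated blocks, so it is a set of blocks and its
-- size is the length of the list.
record IsPacking (n : ℕ) (A : List (Subset n)) : Set where
  field
    blocks-4  : ∀ (i : Fin (length A)) → IsBlock (lookup A i)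
    pair-once : ∀ (x y : Fin n) → x ≢ y →
                ∀ (i j : Fin (length A)) →
                x ∈ lookup A i → y ∈ lookup A i →
                x ∈ lookup A j → y ∈ lookup A j → i ≡ j

LeaveEdge : ∀ {n} → List (Subset n) → Fin n → Fin n → Set
LeaveEdge A x y = x ≢ y × (¬ Σ (Fin (length A)) λ i → x ∈ lookup A i × y ∈ lookup A i)

NonIsolated : ∀ {n} → List (Subset n) → Fin n → Set
NonIsolated {n} A x = Σ (Fin n) λ y → LeaveEdge A x y

-- CP(4) = K_8 minus the perfect matching {0,1},{2,3},{4,5},{6,7}.
CP4Edge : Fin 8 → Fin 8 → Set
CP4Edge i j = i ≢ j × (toℕ i / 2 ≢ toℕ j / 2)

-- The leave, with isolated vertices discarded, is isomorphic to CP(4):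
-- an injection f from the vertices of CP(4) onto the non-isolated vertices of
-- the leave that preserves and reflects adjacency.
LeavesCP4 : ∀ {n} → List (Subset n) → Set
LeavesCP4 {n} A = Σ (Fin 8 → Fin n) λ f →
    Injective _≡_ _≡_ f
  × (∀ i j → (CP4Edge i j → LeaveEdge A (f i) (f j))
           × (LeaveEdge A (f i) (f j) → CP4Edge i j))
  × (∀ x → NonIsolated A x → Σ (Fin 8) λ i → f i ≡ x)

data SmallGraph : Set where
  K5-e    : SmallGraph
  twoK4   : SmallGraph

order : SmallGraph → ℕ
order K5-e  = 5
order twoK4 = 6

-- K_5 - e on Fin 5: all pairs except {0,1}.
-- 2∘K_4 on Fin 6: K_4 on {0,1,2,3} and K_4 on {2,3,4,5}, sharing edge {2,3}.
GEdge : (G : SmallGraph) → Fin (order G) → Fin (order G) → Set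
GEdge K5-e  i j = i ≢ j × ¬ ((toℕ i ≡ 0 × toℕ j ≡ 1) ⊎ (toℕ i ≡ 1 × toℕ j ≡ 0))
GEdge twoK4 i j = i ≢ j × ((toℕ i / 4 ≡ 0 × toℕ j / 4 ≡ 0)
                         ⊎ (2 ∸ toℕ i ≡ 0 × 2 ∸ toℕ j ≡ 0))

LeaveContains : ∀ {n} → List (Subset n) → SmallGraph → Set
LeaveContains {n} A G = Σ (Fin (order G) → Fin n) λ g →
    Injective _≡_ _≡_ g
  × (∀ i j → GEdge G i j → LeaveEdge A (g i) (g j))

module Submission where

-- Let A be a packing with m blocks whose leave is a copy f of
-- CP(4).  The vertices f 0, f 2, f 4, f 6 are pairwise adjacent in the leave
-- (they lie in different parts of CP(4)), so they form a new block X, and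
-- B = X ∷ A is again a packing.  Its leave is CP(4) minus a K_4, which still
-- contains K_5 - e and 2∘K_4 (checked by computation on Fin 8).
-- For the size we double count ordered pairs of distinct points: every such
-- pair is either a leave edge or covered by exactly one block, and a point in
-- r blocks sees 3r points through them.  Hence 2·C(n,2) = (number of ordered
-- leave edges) + 12m = 48 + 12m, so |B| = m + 1 = (C(n,2) - 18)/6.
-- The file develops: (1) indicators and finite sums over Fin n, including
-- reindexing a sum along an injection, and the identity 2·C(n,2) + n = n²;
-- (2) the counting identity for an arbitrary packing (module PackingCount);
-- (3) extending a packing by a block lying inside its leave; (4) the finite
-- facts about CP(4), decided by computation; (5) the construction for a
-- packing leaving CP(4) (module CP4Leave), from which the theorem follows.

open import Defs
open import Data.Nat using (ℕ; zero; suc; _+_; _*_; _∸_; _/_; _%_)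
  renaming (_≟_ to _≟ℕ_)
open import Data.Nat.Properties
  using (+-*-semiring; +-comm; +-identityʳ; *-identityˡ; *-zeroʳ; *-identityʳ; *-comm; +-cancelʳ-≡; *-cancelˡ-≡)
open import Data.Nat.Combinatorics using (_C_; nC1≡n; nCk+nC[k+1]≡[n+1]C[k+1])
open import Data.Nat.DivMod using (m*n/n≡m)
open import Data.Nat.Tactic.RingSolver using (solve-∀)
open import Data.Bool using (true; if_then_else_)
open import Data.Fin using (Fin; zero; suc; toℕ; #_; punchIn)
open import Data.Fin.Properties using (_≟_; any?; all?; punchInᵢ≢i)
open import Data.Fin.Subset using (Subset; _∈_; ∣_∣; inside; outside)
open import Data.Fin.Subset.Properties using (_∈?_)
open import Data.Vec using (_∷_; []; tabulate)
open import Data.Vec.Properties using (lookup∘tabulate; []=⇒lookup; lookup⇒[]=)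
open import Data.List using (List; length; lookup; _∷_)
open import Data.Product using (Σ; ∃; _×_; _,_; proj₁; proj₂)
open import Data.Sum using (_⊎_)
open import Data.Empty using (⊥-elim)
open import Relation.Nullary using (Dec; yes; no; does; ¬_)
open import Relation.Nullary.Decidable using (¬?; _×-dec_; _⊎-dec_; _→-dec_; toWitness)
open import Relation.Binary.PropositionalEquality
open import Function using (_∘_)
open import Function.Definitions using (Injective)
open import Algebra.Properties.Semiring.Sum +-*-semiring
  using (sum; sum-cong-≗; sum-replicate-zero; sum-remove; ∑-comm; ∑-distrib-+;
         *-distribˡ-sum; *-distribʳ-sum)

open ≡-Reasoning

𝟙 : ∀ {p} {P : Set p} → Dec P → ℕ
𝟙 d = if does d then 1 else 0

𝟙-yes : ∀ {p} {P : Set p} (d : Dec P) → P → 𝟙 d ≡ 1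
𝟙-yes (yes _) _ = refl
𝟙-yes (no ¬p) p = ⊥-elim (¬p p)

𝟙-no : ∀ {p} {P : Set p} (d : Dec P) → ¬ P → 𝟙 d ≡ 0
𝟙-no (yes p) ¬p = ⊥-elim (¬p p)
𝟙-no (no _) _ = refl

𝟙-⇔ : ∀ {p q} {P : Set p} {Q : Set q} (d : Dec P) (e : Dec Q) →
      (P → Q) → (Q → P) → 𝟙 d ≡ 𝟙 e
𝟙-⇔ (yes p) e to from = sym (𝟙-yes e (to p))
𝟙-⇔ (no ¬p) e to from = sym (𝟙-no e (¬p ∘ from))

𝟙-× : ∀ {p q} {P : Set p} {Q : Set q} (d : Dec P) (e : Dec Q) →
      𝟙 (d ×-dec e) ≡ 𝟙 d * 𝟙 e
𝟙-× (yes _) (yes _) = refl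
𝟙-× (yes _) (no _)  = refl
𝟙-× (no _)  _       = refl

𝟙-complement : ∀ {p} {P : Set p} (d : Dec P) w → w * 𝟙 (¬? d) + 𝟙 d * w ≡ w
𝟙-complement (yes _) w = cong₂ _+_ (*-zeroʳ w) (+-identityʳ w)
𝟙-complement (no _)  w = trans (+-identityʳ (w * 1)) (*-identityʳ w)

-- If s + [P] = k + 1 then [P]·s = k·[P]: a point of a (k+1)-set sees k others.
𝟙-weight : ∀ {p} {P : Set p} (d : Dec P) s k → s + 𝟙 d ≡ suc k → 𝟙 d * s ≡ k * 𝟙 d
𝟙-weight (yes _) s k e = trans (+-identityʳ s)
  (trans (+-cancelʳ-≡ 1 s k (trans e (+-comm 1 k)))
         (sym (*-identityʳ k)))
𝟙-weight (no _)  s k e = sym (*-zeroʳ k)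

𝟙-split : ∀ {p q} {P : Set p} {Q : Set q} (d : Dec P) (e : Dec Q) →
          𝟙 (¬? d) ≡ 𝟙 (¬? d ×-dec ¬? e) + 𝟙 (¬? d) * 𝟙 e
𝟙-split (yes _) _       = refl
𝟙-split (no _)  (yes _) = refl
𝟙-split (no _)  (no _)  = refl

sum-const : ∀ n c → sum {n} (λ _ → c) ≡ n * c
sum-const zero    c = refl
sum-const (suc n) c = cong (c +_) (sum-const n c)

sum-zero : ∀ {n} (f : Fin n → ℕ) → (∀ i → f i ≡ 0) → sum f ≡ 0
sum-zero {n} f zeros = trans (sum-cong-≗ zeros) (sum-replicate-zero n)

sum-single : ∀ {n} (f : Fin n → ℕ) (k : Fin n) → (∀ i → i ≢ k → f i ≡ 0) → sum f ≡ f k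
sum-single {suc n} f k zeros = begin
  sum f                     ≡⟨ sum-remove {i = k} f ⟩
  f k + sum (f ∘ punchIn k) ≡⟨ cong (f k +_) (sum-zero _ (λ i → zeros _ (punchInᵢ≢i k i))) ⟩
  f k + 0                   ≡⟨ +-identityʳ (f k) ⟩
  f k                       ∎

sum-delta : ∀ {n} (k : Fin n) (g : Fin n → ℕ) → sum (λ x → 𝟙 (k ≟ x) * g x) ≡ g k
sum-delta k g = begin
  sum (λ x → 𝟙 (k ≟ x) * g x) ≡⟨ sum-single _ k (λ x x≢k → cong (_* g x) (𝟙-no (k ≟ x) (x≢k ∘ sym))) ⟩
  𝟙 (k ≟ k) * g k             ≡⟨ cong (_* g k) (𝟙-yes (k ≟ k) refl) ⟩
  g k + 0                     ≡⟨ +-identityʳ (g k) ⟩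
  g k                         ∎

count-atMostOne : ∀ {n p} {P : Fin n → Set p} (P? : ∀ i → Dec (P i)) →
                  (∀ i j → P i → P j → i ≡ j) → sum (λ i → 𝟙 (P? i)) ≡ 𝟙 (any? P?)
count-atMostOne P? unique with any? P?
... | yes (k , pk) = trans (sum-single _ k (λ i i≢k → 𝟙-no (P? i) (λ pi → i≢k (unique i k pi pk))))
                           (𝟙-yes (P? k) pk)
... | no none      = sum-zero _ (λ i → 𝟙-no (P? i) (λ pi → none (i , pi)))

count-subset : ∀ {n} (p : Subset n) → sum (λ y → 𝟙 (y ∈? p)) ≡ ∣ p ∣
count-subset []            = refl
count-subset (inside ∷ p)  = cong suc (count-subset p)
count-subset (outside ∷ p) = count-subset p

sum-except : ∀ {n} (x : Fin n) (w : Fin n → ℕ) →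
             sum (λ y → w y * 𝟙 (¬? (x ≟ y))) + w x ≡ sum w
sum-except x w = begin
  sum (λ y → w y * 𝟙 (¬? (x ≟ y))) + w x
    ≡⟨ cong (sum (λ y → w y * 𝟙 (¬? (x ≟ y))) +_) (sym (sum-delta x w)) ⟩
  sum (λ y → w y * 𝟙 (¬? (x ≟ y))) + sum (λ y → 𝟙 (x ≟ y) * w y)
    ≡⟨ sym (∑-distrib-+ (λ y → w y * 𝟙 (¬? (x ≟ y))) (λ y → 𝟙 (x ≟ y) * w y)) ⟩
  sum (λ y → w y * 𝟙 (¬? (x ≟ y)) + 𝟙 (x ≟ y) * w y)
    ≡⟨ sum-cong-≗ (λ y → 𝟙-complement (x ≟ y) (w y)) ⟩
  sum w ∎

sum-image : ∀ {k n} (f : Fin k → Fin n) → Injective _≡_ _≡_ f → (g : Fin n → ℕ) →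
            (∀ x → ¬ (∃ λ a → f a ≡ x) → g x ≡ 0) → sum g ≡ sum (g ∘ f)
sum-image f f-inj g support = begin
  sum g                                       ≡⟨ sum-cong-≗ (λ x → sym (fibre x)) ⟩
  sum (λ x → sum (λ a → 𝟙 (f a ≟ x)) * g x)   ≡⟨ sum-cong-≗ (λ x → *-distribʳ-sum (g x) (λ a → 𝟙 (f a ≟ x))) ⟩
  sum (λ x → sum (λ a → 𝟙 (f a ≟ x) * g x))   ≡⟨ ∑-comm (λ x a → 𝟙 (f a ≟ x) * g x) ⟩
  sum (λ a → sum (λ x → 𝟙 (f a ≟ x) * g x))   ≡⟨ sum-cong-≗ (λ a → sum-delta (f a) g) ⟩
  sum (g ∘ f)                                 ∎
  where
  -- each point with g x ≠ 0 has exactly one preimage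
  weight : ∀ x → (d : Dec (∃ λ a → f a ≡ x)) → 𝟙 d * g x ≡ g x
  weight x (yes _)        = +-identityʳ (g x)
  weight x (no ∄preimage) = sym (support x ∄preimage)

  fibre : ∀ x → sum (λ a → 𝟙 (f a ≟ x)) * g x ≡ g x
  fibre x = trans (cong (_* g x) (count-atMostOne (λ a → f a ≟ x)
                                    (λ a b fa≡x fb≡x → f-inj (trans fa≡x (sym fb≡x)))))
                  (weight x (any? (λ a → f a ≟ x)))

choose-2 : ∀ n → 2 * (n C 2) + n ≡ n * n
choose-2 zero    = refl
choose-2 (suc n) = begin
  2 * (suc n C 2) + suc n            ≡⟨ cong (λ t → 2 * t + suc n) (sym (nCk+nC[k+1]≡[n+1]C[k+1] n 1)) ⟩
  2 * (n C 1 + n C 2) + suc n      ≡⟨ cong (λ t → 2 * (t + n C 2) + suc n) (nC1≡n n) ⟩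
  2 * (n + n C 2) + suc n          ≡⟨ regroup n (n C 2) ⟩
  (2 * (n C 2) + n) + 2 * n + 1      ≡⟨ cong (λ t → t + 2 * n + 1) (choose-2 n) ⟩
  n * n + 2 * n + 1                ≡⟨ square n ⟩
  suc n * suc n                    ∎
  where
  regroup : ∀ n c → 2 * (n + c) + suc n ≡ (2 * c + n) + 2 * n + 1
  regroup = solve-∀
  square : ∀ n → n * n + 2 * n + 1 ≡ suc n * suc n
  square = solve-∀

size-formula : ∀ m → (24 + 6 * m ∸ 18) / 6 ≡ suc m
size-formula m = begin
  (6 + 6 * m) / 6   ≡⟨ cong (λ t → (6 + t) / 6) (*-comm 6 m) ⟩
  suc m * 6 / 6     ≡⟨ m*n/n≡m (suc m) 6 ⟩
  suc m             ∎

leave-sym : ∀ {n} {A : List (Subset n)} {x y} → LeaveEdge A x y → LeaveEdge A y x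
leave-sym (x≢y , uncovered) = x≢y ∘ sym , λ { (i , y∈ , x∈) → uncovered (i , x∈ , y∈) }

-- Counting in an arbitrary packing: every ordered pair of distinct points is
-- a leave edge or lies in exactly one block, which yields
-- 2·C(n,2) = (ordered leave edges) + 12·(number of blocks).
module PackingCount {n : ℕ} (A : List (Subset n)) (packing : IsPacking n A) where
  open IsPacking packing

  m : ℕ
  m = length A

  block : Fin m → Subset n
  block = lookup A

  together? : ∀ x y i → Dec (x ∈ block i × y ∈ block i)
  together? x y i = (x ∈? block i) ×-dec (y ∈? block i)

  leave? : ∀ x y → Dec (LeaveEdge A x y)
  leave? x y = ¬? (x ≟ y) ×-dec ¬? (any? (together? x y))

  degree : Fin n → ℕ
  degree x = sum (λ y → 𝟙 (leave? x y))

  replication : Fin n → ℕ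
  replication x = sum (λ i → 𝟙 (x ∈? block i))

  pair-split : ∀ x y → 𝟙 (¬? (x ≟ y)) ≡ 𝟙 (leave? x y) + 𝟙 (¬? (x ≟ y)) * sum (λ i → 𝟙 (together? x y i))
  pair-split x y = trans (𝟙-split (x ≟ y) (any? (together? x y)))
                         (cong (𝟙 (leave? x y) +_) (covered-once (x ≟ y)))
    where
    covered-once : (d : Dec (x ≡ y)) →
      𝟙 (¬? d) * 𝟙 (any? (together? x y)) ≡ 𝟙 (¬? d) * sum (λ i → 𝟙 (together? x y i))
    covered-once (yes _)  = refl
    covered-once (no x≢y) = cong (1 *_) (sym (count-atMostOne (together? x y)
      (λ i j (x∈i , y∈i) (x∈j , y∈j) → pair-once x y x≢y i j x∈i y∈i x∈j y∈j)))

  partners-in-block : ∀ x i → 𝟙 (x ∈? block i) * sum (λ y → 𝟙 (y ∈? block i) * 𝟙 (¬? (x ≟ y)))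
                              ≡ 3 * 𝟙 (x ∈? block i)
  partners-in-block x i = 𝟙-weight (x ∈? block i) _ 3 (begin
    sum (λ y → 𝟙 (y ∈? block i) * 𝟙 (¬? (x ≟ y))) + 𝟙 (x ∈? block i)
      ≡⟨ sum-except x (λ y → 𝟙 (y ∈? block i)) ⟩
    sum (λ y → 𝟙 (y ∈? block i)) ≡⟨ count-subset (block i) ⟩
    ∣ block i ∣                   ≡⟨ blocks-4 i ⟩
    4                             ∎)

  covered-partners : ∀ x → sum (λ y → 𝟙 (¬? (x ≟ y)) * sum (λ i → 𝟙 (together? x y i)))
                           ≡ 3 * replication x
  covered-partners x = begin
    sum (λ y → 𝟙 (¬? (x ≟ y)) * sum (λ i → 𝟙 (together? x y i)))
      ≡⟨ sum-cong-≗ (λ y → *-distribˡ-sum (𝟙 (¬? (x ≟ y))) (λ i → 𝟙 (together? x y i))) ⟩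
    sum (λ y → sum (λ i → 𝟙 (¬? (x ≟ y)) * 𝟙 (together? x y i)))
      ≡⟨ sum-cong-≗ (λ y → sum-cong-≗ (λ i → reorder y i)) ⟩
    sum (λ y → sum (λ i → 𝟙 (x ∈? block i) * (𝟙 (y ∈? block i) * 𝟙 (¬? (x ≟ y)))))
      ≡⟨ ∑-comm (λ y i → 𝟙 (x ∈? block i) * (𝟙 (y ∈? block i) * 𝟙 (¬? (x ≟ y)))) ⟩
    sum (λ i → sum (λ y → 𝟙 (x ∈? block i) * (𝟙 (y ∈? block i) * 𝟙 (¬? (x ≟ y)))))
      ≡⟨ sum-cong-≗ (λ i → sym (*-distribˡ-sum (𝟙 (x ∈? block i))
                                 (λ y → 𝟙 (y ∈? block i) * 𝟙 (¬? (x ≟ y))))) ⟩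
    sum (λ i → 𝟙 (x ∈? block i) * sum (λ y → 𝟙 (y ∈? block i) * 𝟙 (¬? (x ≟ y))))
      ≡⟨ sum-cong-≗ (partners-in-block x) ⟩
    sum (λ i → 3 * 𝟙 (x ∈? block i))
      ≡⟨ sym (*-distribˡ-sum 3 (λ i → 𝟙 (x ∈? block i))) ⟩
    3 * replication x ∎
    where
    commute : ∀ a b c → c * (a * b) ≡ a * (b * c)
    commute = solve-∀
    reorder : ∀ y i → 𝟙 (¬? (x ≟ y)) * 𝟙 (together? x y i)
                      ≡ 𝟙 (x ∈? block i) * (𝟙 (y ∈? block i) * 𝟙 (¬? (x ≟ y)))
    reorder y i = trans (cong (𝟙 (¬? (x ≟ y)) *_) (𝟙-× (x ∈? block i) (y ∈? block i)))
                        (commute (𝟙 (x ∈? block i)) (𝟙 (y ∈? block i)) (𝟙 (¬? (x ≟ y))))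

  -- local form of the double count: the n - 1 other points around x
  degree-identity : ∀ x → degree x + 3 * replication x + 1 ≡ n
  degree-identity x = begin
    degree x + 3 * replication x + 1
      ≡⟨ cong (λ t → degree x + t + 1) (sym (covered-partners x)) ⟩
    degree x + sum (λ y → 𝟙 (¬? (x ≟ y)) * sum (λ i → 𝟙 (together? x y i))) + 1
      ≡⟨ cong (_+ 1) (sym (∑-distrib-+ (λ y → 𝟙 (leave? x y))
                            (λ y → 𝟙 (¬? (x ≟ y)) * sum (λ i → 𝟙 (together? x y i))))) ⟩
    sum (λ y → 𝟙 (leave? x y) + 𝟙 (¬? (x ≟ y)) * sum (λ i → 𝟙 (together? x y i))) + 1
      ≡⟨ cong (_+ 1) (sum-cong-≗ (λ y → sym (trans (*-identityˡ _) (pair-split x y)))) ⟩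
    sum (λ y → 1 * 𝟙 (¬? (x ≟ y))) + 1
      ≡⟨ sum-except x (λ _ → 1) ⟩
    sum {n} (λ _ → 1) ≡⟨ sum-const n 1 ⟩
    n * 1         ≡⟨ *-identityʳ n ⟩
    n ∎

  -- every block has 4 points
  replication-total : sum replication ≡ m * 4
  replication-total = begin
    sum (λ x → sum (λ i → 𝟙 (x ∈? block i))) ≡⟨ ∑-comm (λ x i → 𝟙 (x ∈? block i)) ⟩
    sum (λ i → sum (λ x → 𝟙 (x ∈? block i))) ≡⟨ sum-cong-≗ (λ i → trans (count-subset (block i)) (blocks-4 i)) ⟩
    sum {m} (λ _ → 4)                           ≡⟨ sum-const m 4 ⟩
    m * 4 ∎

  pair-count : 2 * (n C 2) ≡ sum degree + 12 * m
  pair-count = +-cancelʳ-≡ n _ _ (begin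
    2 * (n C 2) + n ≡⟨ choose-2 n ⟩
    n * n           ≡⟨ sym (sum-const n n) ⟩
    sum {n} (λ _ → n) ≡⟨ sum-cong-≗ (λ x → sym (degree-identity x)) ⟩
    sum (λ x → degree x + 3 * replication x + 1)
      ≡⟨ ∑-distrib-+ (λ x → degree x + 3 * replication x) (λ _ → 1) ⟩
    sum (λ x → degree x + 3 * replication x) + sum {n} (λ _ → 1)
      ≡⟨ cong₂ _+_ (∑-distrib-+ degree (λ x → 3 * replication x)) (trans (sum-const n 1) (*-identityʳ n)) ⟩
    sum degree + sum (λ x → 3 * replication x) + n
      ≡⟨ cong (λ t → sum degree + t + n) (sym (*-distribˡ-sum 3 replication)) ⟩
    sum degree + 3 * sum replication + n
      ≡⟨ cong (λ t → sum degree + 3 * t + n) replication-total ⟩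
    sum degree + 3 * (m * 4) + n
      ≡⟨ cong (λ t → sum degree + t + n) (twelve m) ⟩
    sum degree + 12 * m + n ∎)
    where
    twelve : ∀ m → 3 * (m * 4) ≡ 12 * m
    twelve = solve-∀

extend-packing : ∀ {n} {A : List (Subset n)} (X : Subset n) → IsPacking n A → IsBlock X →
                 (∀ x y → x ≢ y → x ∈ X → y ∈ X → LeaveEdge A x y) → IsPacking n (X ∷ A)
extend-packing {n} {A} X packing X-block X-in-leave =
  record { blocks-4 = blocks ; pair-once = once }
  where
  open IsPacking packing
  blocks : ∀ i → IsBlock (lookup (X ∷ A) i)
  blocks zero    = X-block
  blocks (suc i) = blocks-4 i
  once : ∀ (x y : Fin n) → x ≢ y → ∀ (i j : Fin (length (X ∷ A))) →
         x ∈ lookup (X ∷ A) i → y ∈ lookup (X ∷ A) i →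
         x ∈ lookup (X ∷ A) j → y ∈ lookup (X ∷ A) j → i ≡ j
  once x y x≢y zero    zero    _   _   _   _   = refl
  once x y x≢y zero    (suc j) x∈X y∈X x∈j y∈j = ⊥-elim (proj₂ (X-in-leave x y x≢y x∈X y∈X) (j , x∈j , y∈j))
  once x y x≢y (suc i) zero    x∈i y∈i x∈X y∈X = ⊥-elim (proj₂ (X-in-leave x y x≢y x∈X y∈X) (i , x∈i , y∈i))
  once x y x≢y (suc i) (suc j) x∈i y∈i x∈j y∈j = cong suc (pair-once x y x≢y i j x∈i y∈i x∈j y∈j)

leave-extend : ∀ {n} {A : List (Subset n)} {X : Subset n} {x y} →
               LeaveEdge A x y → ¬ (x ∈ X × y ∈ X) → LeaveEdge (X ∷ A) x y
leave-extend (x≢y , uncovered) not-in-X = x≢y , λ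
  { (zero  , x∈X , y∈X) → not-in-X (x∈X , y∈X)
  ; (suc i , x∈i , y∈i) → uncovered (i , x∈i , y∈i) }

subset : ∀ {n p} {Q : Fin n → Set p} → (∀ y → Dec (Q y)) → Subset n
subset Q? = tabulate (does ∘ Q?)

∈-subset⁻ : ∀ {n p} {Q : Fin n → Set p} (Q? : ∀ y → Dec (Q y)) {y} → y ∈ subset Q? → Q y
∈-subset⁻ Q? {y} y∈ = witness (Q? y) (trans (sym (lookup∘tabulate (does ∘ Q?) y)) ([]=⇒lookup y∈))
  where
  witness : ∀ {P : Set _} (d : Dec P) → does d ≡ true → P
  witness (yes p) _ = p

∈-subset⁺ : ∀ {n p} {Q : Fin n → Set p} (Q? : ∀ y → Dec (Q y)) {y} → Q y → y ∈ subset Q?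
∈-subset⁺ Q? {y} q = lookup⇒[]= y (subset Q?) (trans (lookup∘tabulate (does ∘ Q?) y) (holds (Q? y)))
  where
  holds : (d : Dec _) → does d ≡ true
  holds (yes _) = refl
  holds (no ¬q) = ⊥-elim (¬q q)

injective? : ∀ {k n} (f : Fin k → Fin n) → Dec (∀ a c → f a ≡ f c → a ≡ c)
injective? f = all? (λ a → all? (λ c → (f a ≟ f c) →-dec (a ≟ c)))

cp? : ∀ i j → Dec (CP4Edge i j)
cp? i j = ¬? (i ≟ j) ×-dec ¬? (toℕ i / 2 ≟ℕ toℕ j / 2)

cp4-ordered-edges : sum (λ a → sum (λ c → 𝟙 (cp? a c))) ≡ 48
cp4-ordered-edges = refl

-- The vertices 0, 2, 4, 6 of CP(4), one from each part, form a K_4.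
clique : Fin 4 → Fin 8
clique zero                   = # 0
clique (suc zero)             = # 2
clique (suc (suc zero))       = # 4
clique (suc (suc (suc zero))) = # 6

clique-injective : Injective _≡_ _≡_ clique
clique-injective {a} {c} = toWitness {a? = injective? clique} _ a c

clique-edges : ∀ a c → a ≢ c → CP4Edge (clique a) (clique c)
clique-edges = toWitness {a? = all? (λ a → all? (λ c → ¬? (a ≟ c) →-dec cp? (clique a) (clique c)))} _

InClique : Fin 8 → Set
InClique u = ∃ λ a → clique a ≡ u

-- Edges of CP(4) minus the clique: what remains after adding the clique as a block.
Residual : Fin 8 → Fin 8 → Set
Residual u v = CP4Edge u v × ¬ (InClique u × InClique v)

residual? : ∀ u v → Dec (Residual u v)
residual? u v = cp? u v ×-dec ¬? (any? (λ a → clique a ≟ u) ×-dec any? (λ a → clique a ≟ v))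

gedge? : ∀ G i j → Dec (GEdge G i j)
gedge? K5-e  i j = ¬? (i ≟ j) ×-dec ¬? (((toℕ i ≟ℕ 0) ×-dec (toℕ j ≟ℕ 1)) ⊎-dec ((toℕ i ≟ℕ 1) ×-dec (toℕ j ≟ℕ 0)))
gedge? twoK4 i j = ¬? (i ≟ j) ×-dec (((toℕ i / 4 ≟ℕ 0) ×-dec (toℕ j / 4 ≟ℕ 0))
                                   ⊎-dec ((2 ∸ toℕ i ≟ℕ 0) ×-dec (2 ∸ toℕ j ≟ℕ 0)))

embedding : ∀ G → Fin (order G) → Fin 8
embedding K5-e  zero                                = # 0
embedding K5-e  (suc zero)                          = # 1
embedding K5-e  (suc (suc zero))                    = # 3
embedding K5-e  (suc (suc (suc zero)))              = # 5
embedding K5-e  (suc (suc (suc (suc zero))))        = # 7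
embedding twoK4 zero                                = # 0
embedding twoK4 (suc zero)                          = # 3
embedding twoK4 (suc (suc zero))                    = # 5
embedding twoK4 (suc (suc (suc zero)))              = # 7
embedding twoK4 (suc (suc (suc (suc zero))))        = # 1
embedding twoK4 (suc (suc (suc (suc (suc zero))))) = # 2

embedding-injective : ∀ G → Injective _≡_ _≡_ (embedding G)
embedding-injective K5-e  {i} {j} = toWitness {a? = injective? (embedding K5-e)} _ i j
embedding-injective twoK4 {i} {j} = toWitness {a? = injective? (embedding twoK4)} _ i j

embedding-edges : ∀ G i j → GEdge G i j → Residual (embedding G i) (embedding G j)
embedding-edges K5-e  = toWitness {a? = all? (λ i → all? (λ j →
  gedge? K5-e i j →-dec residual? (embedding K5-e i) (embedding K5-e j)))} _
embedding-edges twoK4 = toWitness {a? = all? (λ i → all? (λ j →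
  gedge? twoK4 i j →-dec residual? (embedding twoK4 i) (embedding twoK4 j)))} _

module CP4Leave {n : ℕ} (A : List (Subset n)) (packing : IsPacking n A) (cp4 : LeavesCP4 A) where
  open PackingCount A packing

  f : Fin 8 → Fin n
  f = proj₁ cp4

  f-injective : Injective _≡_ _≡_ f
  f-injective = proj₁ (proj₂ cp4)

  f-iso : ∀ i j → (CP4Edge i j → LeaveEdge A (f i) (f j)) × (LeaveEdge A (f i) (f j) → CP4Edge i j)
  f-iso = proj₁ (proj₂ (proj₂ cp4))

  f-onto : ∀ x → NonIsolated A x → Σ (Fin 8) λ i → f i ≡ x
  f-onto = proj₂ (proj₂ (proj₂ cp4))

  leave-count : sum degree ≡ 48
  leave-count = begin
    sum (λ x → sum (λ y → 𝟙 (leave? x y)))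
      ≡⟨ sum-cong-≗ (λ x → sum-image f f-injective (λ y → 𝟙 (leave? x y)) (outside-inner x)) ⟩
    sum (λ x → sum (λ c → 𝟙 (leave? x (f c))))
      ≡⟨ sum-image f f-injective (λ x → sum (λ c → 𝟙 (leave? x (f c)))) outside-outer ⟩
    sum (λ a → sum (λ c → 𝟙 (leave? (f a) (f c))))
      ≡⟨ sum-cong-≗ (λ a → sum-cong-≗ (λ c →
           𝟙-⇔ (leave? (f a) (f c)) (cp? a c) (proj₂ (f-iso a c)) (proj₁ (f-iso a c)))) ⟩
    sum (λ a → sum (λ c → 𝟙 (cp? a c))) ≡⟨ cp4-ordered-edges ⟩
    48 ∎
    where
    outside-inner : ∀ x y → ¬ (∃ λ c → f c ≡ y) → 𝟙 (leave? x y) ≡ 0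
    outside-inner x y y∉f = 𝟙-no (leave? x y) (λ xy → y∉f (f-onto y (x , leave-sym {A = A} xy)))
    outside-outer : ∀ x → ¬ (∃ λ a → f a ≡ x) → sum (λ c → 𝟙 (leave? x (f c))) ≡ 0
    outside-outer x x∉f = sum-zero _ (λ c → 𝟙-no (leave? x (f c)) (λ xy → x∉f (f-onto x (f c , xy))))

  blocks-count : n C 2 ≡ 24 + 6 * m
  blocks-count = *-cancelˡ-≡ _ _ 2 (begin
    2 * (n C 2)        ≡⟨ pair-count ⟩
    sum degree + 12 * m ≡⟨ cong (_+ 12 * m) leave-count ⟩
    48 + 12 * m        ≡⟨ halve m ⟩
    2 * (24 + 6 * m)   ∎)
    where
    halve : ∀ m → 48 + 12 * m ≡ 2 * (24 + 6 * m)
    halve = solve-∀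

  in-X? : ∀ y → Dec (∃ λ a → f (clique a) ≡ y)
  in-X? y = any? (λ a → f (clique a) ≟ y)

  X : Subset n
  X = subset in-X?

  X-size : ∣ X ∣ ≡ 4
  X-size = begin
    ∣ X ∣                                ≡⟨ sym (count-subset X) ⟩
    sum (λ y → 𝟙 (y ∈? X))               ≡⟨ sum-image (f ∘ clique) (clique-injective ∘ f-injective)
                                              (λ y → 𝟙 (y ∈? X)) (λ y y∉ → 𝟙-no (y ∈? X) (y∉ ∘ ∈-subset⁻ in-X?)) ⟩
    sum (λ a → 𝟙 (f (clique a) ∈? X))    ≡⟨ sum-cong-≗ (λ a → 𝟙-yes (f (clique a) ∈? X) (∈-subset⁺ in-X? (a , refl))) ⟩
    sum {4} (λ _ → 1)                    ≡⟨ refl ⟩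
    4                                    ∎

  X-in-leave : ∀ x y → x ≢ y → x ∈ X → y ∈ X → LeaveEdge A x y
  X-in-leave x y x≢y x∈X y∈X with ∈-subset⁻ in-X? x∈X | ∈-subset⁻ in-X? y∈X
  ... | a , refl | c , refl = proj₁ (f-iso (clique a) (clique c)) (clique-edges a c (λ { refl → x≢y refl }))

  B : List (Subset n)
  B = X ∷ A

  B-packing : IsPacking n B
  B-packing = extend-packing X packing X-size X-in-leave

  B-size : length B ≡ (n C 2 ∸ 18) / 6
  B-size = sym (trans (cong (λ t → (t ∸ 18) / 6) blocks-count) (size-formula m))

  residual-in-leave : ∀ {u v} → Residual u v → LeaveEdge B (f u) (f v)
  residual-in-leave {u} {v} (uv , not-both) =
    leave-extend (proj₁ (f-iso u v) uv) (λ (fu∈X , fv∈X) → not-both (in-clique fu∈X , in-clique fv∈X))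
    where
    in-clique : ∀ {w} → f w ∈ X → InClique w
    in-clique fw∈X with ∈-subset⁻ in-X? fw∈X
    ... | a , e = a , f-injective e

  B-contains : ∀ G → LeaveContains B G
  B-contains G = f ∘ embedding G
               , embedding-injective G ∘ f-injective
               , λ i j ij → residual-in-leave (embedding-edges G i j ij)

-- Lemma 5.3.
lemma5p3 : (G : SmallGraph) (n : ℕ) → (n % 12 ≡ 1 ⊎ n % 12 ≡ 4) →
    Σ (List (Subset n)) (λ A → IsPacking n A × LeavesCP4 A) →
    Σ (List (Subset n)) (λ B → IsPacking n B
      × length B ≡ (n C 2 ∸ 18) / 6
      × LeaveContains B G)
lemma5p3 G n _ (A , packing , cp4) = B , B-packing , B-size , B-contains G
  where open CP4Leave A packing cp4
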